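{- Let $Q$ be the quiver on vertices $\{1,2,3,4,5\}$ with arrows $1\to2$, $1\to5$, $3\to1$, $4\to1$, $4\to5$, $5\to2$, $5\to3$, two arrows $2\to3$ and two arrows $3\to4$, with initial seed $(Q,(x_1,\dots,x_5))$, $x_1,\dots,x_5$ indeterminates. Define $x_n$ for all $n\in\mathbb{Z}$ by $x_n=(x_{n-1}x_{n-4}+x_{n-2}x_{n-3})/x_{n-5}$ for $n\ge6$ and $x_n=(x_{n+1}x_{n+4}+x_{n+2}x_{n+3})/x_{n+5}$ for $n\le0$; let $A=\frac{x_1x_5+x_3^2}{x_2x_4}$, $B=\frac{x_2x_6+x_4^2}{x_3x_5}$. Define $g(s,k)=\lfloor s/2\rfloor\lfloor (s+1)/2\rfloor$ if $k$ is even and $g(s,k)=\lfloor (s-1)/2\rfloor\lfloor s/2\rfloor$ if $k$ is odd, and set $\rho_1^{k}:=\rho_2^{ -k}$ for $k<0$. Then for all $k\in\mathbb{Z}$ and $s\in\mathbb{Z}_{\ge0}$, the ordered cluster obtained by applying $\rho_1^{k}(\rho_3\rho_1)^s$ to the initial seed is $$\big(A^{g(s+1,k)}B^{g(s+1,k+1)}x_{k+s+1},\ A^{g(s,k)}B^{g(s,k+1)}x_{k+s+2},\ A^{g(s+1,k)}B^{g(s+1,k+1)}x_{k+s+3},$$ $$A^{g(s,k)}B^{g(s,k+1)}x_{k+s+4},\ A^{g(s+1,k)}B^{g(s+1,k+1)}x_{k+s+5}\big).$$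
   Context: A seed is a pair (quiver on $\{1,\dots,5\}$ without loops or 2-cycles, ordered cluster $(y_1,\dots,y_5)$). Mutation $\mu_i$: for each 2-path $j\to i\to k$ add an arrow $j\to k$; reverse arrows at $i$; delete 2-cycles; replace $y_i$ by $\big(\prod_{i\to j}y_j^{a_{i\to j}}+\prod_{j\to i}y_j^{a_{j\to i}}\big)/y_i$ ($a_{i\to j}$ = number of arrows $i\to j$ before mutation). For a permutation $\sigma$ in cycle notation, applying $\sigma$ relabels vertex $i$ as $\sigma(i)$ (variable at $i$ moves to $\sigma(i)$); e.g. $(54321)$ sends $1\mapsto5$ and $i\mapsto i-1$ for $i\ge2$. Operations compose left to right (leftmost first): $\rho_1=\mu_1\circ(54321)$, $\rho_2=\mu_5\circ(12345)$, $\rho_3=\mu_2\circ\mu_4\circ(24)$. In a product $\rho_a\rho_b$, $\rho_a$ is applied first; powers are repeated products and $\rho^0$ is the identity. -}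

module Defs where

open import Level using (Level; _⊔_) renaming (suc to lsuc)
open import Data.Nat using (ℕ; zero; suc; _∸_; _/_; _%_; _≡ᵇ_) renaming (_+_ to _+ℕ_; _*_ to _*ℕ_)
open import Data.Integer using (ℤ; +_; -[1+_]; ∣_∣) renaming (_+_ to _+ℤ_)
open import Data.Bool using (Bool; true; false; if_then_else_; _∨_)
open import Data.Fin using (Fin; zero; suc; _≟_; inject₁)
open import Data.Fin.Permutation using (Permutation′; permutation; _⟨$⟩ˡ_)
open import Relation.Nullary.Decidable using (⌊_⌋)
open import Relation.Binary.PropositionalEquality using (_≡_; refl)
open import Relation.Binary.Core using (Rel)
open import Algebra.Core using (Op₁; Op₂)
open import Algebra.Definitions using (_DistributesOver_)
open import Algebra.Structures using (IsCommutativeSemigroup; IsAbelianGroup)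

-- Semifields (in the sense of Fomin–Zelevinsky): an abelian multiplicative
-- group equipped with a commutative, associative addition over which
-- multiplication distributes.  The universal semifield Q_sf(x₁,…,x₅)
-- (subtraction-free rational functions, inside Q(x₁,…,x₅)) is the initial
-- such object, so an identity of subtraction-free rational expressions in
-- indeterminates x₁,…,x₅ is the same as that identity holding for all
-- elements x₁,…,x₅ of all semifields.

record Semifield (c ℓ : Level) : Set (lsuc (c ⊔ ℓ)) where
  infixl 7 _*_
  infixl 6 _+_
  field
    Carrier : Set c
    _≈_     : Rel Carrier ℓ
    _+_     : Op₂ Carrier
    _*_     : Op₂ Carrier
    1#      : Carrier
    _⁻¹     : Op₁ Carrier
    +-isCommutativeSemigroup : IsCommutativeSemigroup _≈_ _+_
    *-isAbelianGroup         : IsAbelianGroup _≈_ _*_ 1# _⁻¹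
    distrib                  : _DistributesOver_ _≈_ _*_ _+_

-- Vertices 1..5 are Fin 5 elements 0..4.

v1 v2 v3 v4 v5 : Fin 5
v1 = zero
v2 = suc zero
v3 = suc (suc zero)
v4 = suc (suc (suc zero))
v5 = suc (suc (suc (suc zero)))

-- A quiver on {1..5}: a j k = number of arrows j → k.
Quiver : Set
Quiver = Fin 5 → Fin 5 → ℕ

Q₀ : Quiver
Q₀ zero (suc zero) = 1
Q₀ zero (suc (suc (suc (suc zero)))) = 1
Q₀ (suc (suc zero)) zero = 1
Q₀ (suc (suc (suc zero))) zero = 1
Q₀ (suc (suc (suc zero))) (suc (suc (suc (suc zero)))) = 1
Q₀ (suc (suc (suc (suc zero)))) (suc zero) = 1
Q₀ (suc (suc (suc (suc zero)))) (suc (suc zero)) = 1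
Q₀ (suc zero) (suc (suc zero)) = 2
Q₀ (suc (suc zero)) (suc (suc (suc zero))) = 2
Q₀ _ _ = 0

-- Quiver mutation at i: for j,k ≠ i add a j i * a i k arrows j → k
-- (the 2-paths j → i → k), then cancel 2-cycles; arrows at i are reversed.
mutQ : Fin 5 → Quiver → Quiver
mutQ i a j k =
  if ⌊ j ≟ i ⌋ ∨ ⌊ k ≟ i ⌋
  then a k j
  else (a j k +ℕ a j i *ℕ a i k) ∸ (a k j +ℕ a k i *ℕ a i j)

σ54321 : Permutation′ 5
σ54321 = permutation f g fg gf
  where
  f g : Fin 5 → Fin 5
  f zero = v5
  f (suc i) = inject₁ i
  g i with i
  ... | zero = v2
  ... | suc zero = v3
  ... | suc (suc zero) = v4
  ... | suc (suc (suc zero)) = v5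
  ... | suc (suc (suc (suc zero))) = v1
  fg : ∀ y → f (g y) ≡ y
  fg zero = refl
  fg (suc zero) = refl
  fg (suc (suc zero)) = refl
  fg (suc (suc (suc zero))) = refl
  fg (suc (suc (suc (suc zero)))) = refl
  gf : ∀ x → g (f x) ≡ x
  gf zero = refl
  gf (suc zero) = refl
  gf (suc (suc zero)) = refl
  gf (suc (suc (suc zero))) = refl
  gf (suc (suc (suc (suc zero)))) = refl

σ12345 : Permutation′ 5
σ12345 = permutation f g fg gf
  where
  f g : Fin 5 → Fin 5
  f zero = v2
  f (suc zero) = v3
  f (suc (suc zero)) = v4
  f (suc (suc (suc zero))) = v5
  f (suc (suc (suc (suc zero)))) = v1
  g zero = v5
  g (suc i) = inject₁ i
  fg : ∀ y → f (g y) ≡ y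
  fg zero = refl
  fg (suc zero) = refl
  fg (suc (suc zero)) = refl
  fg (suc (suc (suc zero))) = refl
  fg (suc (suc (suc (suc zero)))) = refl
  gf : ∀ x → g (f x) ≡ x
  gf zero = refl
  gf (suc zero) = refl
  gf (suc (suc zero)) = refl
  gf (suc (suc (suc zero))) = refl
  gf (suc (suc (suc (suc zero)))) = refl

σ24 : Permutation′ 5
σ24 = permutation f f ff ff
  where
  f : Fin 5 → Fin 5
  f zero = v1
  f (suc zero) = v4
  f (suc (suc zero)) = v3
  f (suc (suc (suc zero))) = v2
  f (suc (suc (suc (suc zero)))) = v5
  ff : ∀ y → f (f y) ≡ y
  ff zero = refl
  ff (suc zero) = refl
  ff (suc (suc zero)) = refl
  ff (suc (suc (suc zero))) = refl
  ff (suc (suc (suc (suc zero)))) = refl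

-- g(s,k): ⌊s/2⌋⌊(s+1)/2⌋ for k even, ⌊(s-1)/2⌋⌊s/2⌋ for k odd.
-- (For s = 0, k odd, ⌊-1/2⌋ = -1 is multiplied by ⌊0/2⌋ = 0, so truncated
-- subtraction gives the same value 0.)
evenℤ : ℤ → Bool
evenℤ k = (∣ k ∣ % 2) ≡ᵇ 0

gExp : ℕ → ℤ → ℕ
gExp s k = if evenℤ k then (s / 2) *ℕ (suc s / 2) else ((s ∸ 1) / 2) *ℕ (s / 2)

iter : ∀ {a} {A : Set a} → (A → A) → ℕ → A → A
iter f zero x = x
iter f (suc n) x = iter f n (f x)

module Over {c ℓ : Level} (S : Semifield c ℓ) where
  open Semifield S

  infixl 7 _÷_
  _÷_ : Carrier → Carrier → Carrier
  x ÷ y = x * (y ⁻¹)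

  _^_ : Carrier → ℕ → Carrier
  x ^ zero = 1#
  x ^ suc n = x * (x ^ n)

  ∏ : ∀ {n} → (Fin n → Carrier) → Carrier
  ∏ {zero} f = 1#
  ∏ {suc n} f = f zero * ∏ {n} (λ i → f (suc i))

  record Seed : Set c where
    constructor seed
    field
      quiver  : Quiver
      cluster : Fin 5 → Carrier
  open Seed public

  μ : Fin 5 → Seed → Seed
  μ i (seed a y) = seed (mutQ i a) y′
    where
    y′ : Fin 5 → Carrier
    y′ j = if ⌊ j ≟ i ⌋
           then (∏ (λ l → y l ^ a i l) + ∏ (λ l → y l ^ a l i)) ÷ y i
           else y j

  -- Relabelling by σ: vertex j becomes σ(j), i.e. new data at j is old data at σ⁻¹(j).
  relabel : Permutation′ 5 → Seed → Seed
  relabel σ (seed a y) = seed (λ j k → a (σ ⟨$⟩ˡ j) (σ ⟨$⟩ˡ k)) (λ j → y (σ ⟨$⟩ˡ j))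

  -- Operations compose left to right (leftmost applied first).
  ρ₁ ρ₂ ρ₃ : Seed → Seed
  ρ₁ t = relabel σ54321 (μ v1 t)
  ρ₂ t = relabel σ12345 (μ v5 t)
  ρ₃ t = relabel σ24 (μ v4 (μ v2 t))

  ρ₁^ : ℤ → Seed → Seed
  ρ₁^ (+ n) = iter ρ₁ n
  ρ₁^ -[1+ n ] = iter ρ₂ (suc n)

  applyWord : ℤ → ℕ → Seed → Seed
  applyWord k s t = iter (λ u → ρ₁ (ρ₃ u)) s (ρ₁^ k t)

  run : Carrier → Carrier → Carrier → Carrier → Carrier → ℕ → Carrier
  run a b c d e zero = a
  run a b c d e (suc n) = run b c d e ((e * b + d * c) ÷ a) n

  module Seq (x : Fin 5 → Carrier) where
    -- forward: F n = x_{n+1};  backward: G m = x_{5-m}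
    F G : ℕ → Carrier
    F = run (x v1) (x v2) (x v3) (x v4) (x v5)
    G = run (x v5) (x v4) (x v3) (x v2) (x v1)

    xs : ℤ → Carrier
    xs (+ suc n) = F n
    xs (+ zero) = G 5
    xs -[1+ m ] = G (6 +ℕ m)

    A B : Carrier
    A = (xs (+ 1) * xs (+ 5) + xs (+ 3) * xs (+ 3)) ÷ (xs (+ 2) * xs (+ 4))
    B = (xs (+ 2) * xs (+ 6) + xs (+ 4) * xs (+ 4)) ÷ (xs (+ 3) * xs (+ 5))

    coef : ℕ → ℤ → Carrier
    coef s k = (A ^ gExp s k) * (B ^ gExp s (k +ℤ + 1))

    expected : ℤ → ℕ → Fin 5 → Carrier
    expected k s zero = coef (suc s) k * xs (k +ℤ + s +ℤ + 1)
    expected k s (suc zero) = coef s k * xs (k +ℤ + s +ℤ + 2)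
    expected k s (suc (suc zero)) = coef (suc s) k * xs (k +ℤ + s +ℤ + 3)
    expected k s (suc (suc (suc zero))) = coef s k * xs (k +ℤ + s +ℤ + 4)
    expected k s (suc (suc (suc (suc zero)))) = coef (suc s) k * xs (k +ℤ + s +ℤ + 5)

module Submission where

-- On seeds with quiver Q, each of ρ₁, ρ₂, ρ₃ returns quiver Q again, with an explicit cluster
-- map: ρ₁ and ρ₂ move a window (x_{m+1}, …, x_{m+5}) of the Somos-5 sequence x one step forward
-- or backward, and ρ₃ replaces y₂, y₄ by N/y₄, N/y₂ where N = y₁y₅ + y₃².  Along x the quantity
-- K_m = (x_{m+1}x_{m+5} + x_{m+3}²)/(x_{m+2}x_{m+4}) is 2-periodic, so it is A for even m and B for
-- odd m.  Hence ρ₃ρ₁ sends the window at m with coefficients (a, b, a, b, a) to the window at m+1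
-- with coefficients (a′, a, a′, a, a′) as soon as a²K_m = a′b, and the exponents g(s, k) are
-- exactly what solves this recursion: g(s+2) + g(s) = 2g(s+1) + [k+s even] for A, and the same
-- with [k+s odd] for B.

open import Algebra.Bundles using (AbelianGroup; CommutativeSemiring)
open import Algebra.Construct.Add.Identity using (liftOp)
import Algebra.Construct.Add.Identity as AddIdentity
open import Algebra.Core using (Op₂)
import Algebra.Properties.AbelianGroup
import Algebra.Properties.CommutativeSemigroup
import Algebra.Properties.Monoid.Mult
import Algebra.Solver.CommutativeMonoid
import Algebra.Solver.Ring.NaturalCoefficients.Default
open import Algebra.Structures using (IsCommutativeSemigroup)
open import Algebra.Structures.Biased using (IsCommutativeSemiringˡ)
open import Data.Bool using (Bool; true; false; not; if_then_else_; _∨_)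
open import Data.Bool.Properties using (not-involutive; if-float; if-eta)
open import Data.Fin using (Fin; zero; suc; _≟_; toℕ; #_)
open import Data.Fin.Permutation using (_⟨$⟩ˡ_)
open import Data.Fin.Properties using (all?; toℕ≤pred[n])
open import Data.Integer as ℤ using (ℤ; +_; -[1+_])
import Data.Integer.Properties as ℤₚ
open import Data.Integer.Tactic.RingSolver using () renaming (solve-∀ to ℤ-solve-∀)
open import Data.Nat as ℕ using (ℕ; zero; suc)
open import Data.Nat.DivMod using (m/n≡1+[m∸n]/n)
import Data.Nat.Properties as ℕₚ
open import Data.Nat.Tactic.RingSolver using (solve-∀)
open import Data.Product using (_,_; proj₂)
open import Data.Vec using (tabulate)
open import Function using (_∘_)
open import Level using (Level; _⊔_)
open import Relation.Binary.Construct.Add.Point.Equality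
  using (_≈∙_; ∙≈∙; [_]; ≈∙-refl; ≈∙-trans; ≈∙-isEquivalence; [≈]-injective)
open import Relation.Binary.Core using (Rel)
open import Relation.Binary.PropositionalEquality as ≡ using (_≡_; cong; cong₂)
import Relation.Binary.Reasoning.Setoid
open import Relation.Nullary.Construct.Add.Point using (Pointed; [_]; ∙)
open import Relation.Nullary.Decidable using (Dec; ⌊_⌋; from-yes)

open import Defs

iter-preserves : ∀ {a b r} {A : Set a} {B : Set b} (_∼_ : A → B → Set r) {f : A → A} {g : B → B} →
                 (∀ {u v} → u ∼ v → f u ∼ g v) → ∀ n {u v} → u ∼ v → iter f n u ∼ iter g n v
iter-preserves _∼_ step zero u∼v = u∼v
iter-preserves _∼_ step (suc n) u∼v = iter-preserves _∼_ step n (step u∼v)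

iter-comm : ∀ {a} {A : Set a} (f : A → A) n z → iter f n (f z) ≡ f (iter f n z)
iter-comm f zero z = ≡.refl
iter-comm f (suc n) z = iter-comm f n (f z)

iter-suc : ∀ n → iter suc n zero ≡ n
iter-suc zero = ≡.refl
iter-suc (suc n) = ≡.trans (iter-comm suc n zero) (cong suc (iter-suc n))

iter-sucℤ : ∀ n → iter ℤ.suc n (+ 0) ≡ + n
iter-sucℤ zero = ≡.refl
iter-sucℤ (suc n) = ≡.trans (iter-comm ℤ.suc n (+ 0)) (cong ℤ.suc (iter-sucℤ n))

iter-predℤ : ∀ n → iter ℤ.pred (suc n) (+ 0) ≡ -[1+ n ]
iter-predℤ zero = ≡.refl
iter-predℤ (suc n) = ≡.trans (iter-comm ℤ.pred (suc n) (+ 0)) (cong ℤ.pred (iter-predℤ n))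

sucℤ-+ : ∀ i j → ℤ.suc i ℤ.+ j ≡ i ℤ.+ ℤ.suc j
sucℤ-+ = lemma
  where
  lemma : ∀ i j → (+ 1 ℤ.+ i) ℤ.+ j ≡ i ℤ.+ (+ 1 ℤ.+ j)
  lemma = ℤ-solve-∀

+-sucℤ : ∀ i j → i ℤ.+ ℤ.suc j ≡ ℤ.suc (i ℤ.+ j)
+-sucℤ = lemma
  where
  lemma : ∀ i j → i ℤ.+ (+ 1 ℤ.+ j) ≡ + 1 ℤ.+ (i ℤ.+ j)
  lemma = ℤ-solve-∀

-+-reindex : ∀ {i c} n → i ℕ.≤ c → ℤ.- + n ℤ.+ + i ≡ + c ℤ.- + (c ℕ.∸ i ℕ.+ n)
-+-reindex {i} {c} n i≤c = begin
  ℤ.- + n ℤ.+ + i                      ≡⟨ ℤₚ.-m+n≡n⊖m n i ⟩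
  i ℤ.⊖ n                              ≡⟨ ℤₚ.+-cancelˡ-⊖ (c ℕ.∸ i) i n ⟨
  (c ℕ.∸ i ℕ.+ i) ℤ.⊖ (c ℕ.∸ i ℕ.+ n)  ≡⟨ cong (ℤ._⊖ (c ℕ.∸ i ℕ.+ n)) (ℕₚ.m∸n+n≡m i≤c) ⟩
  c ℤ.⊖ (c ℕ.∸ i ℕ.+ n)                ≡⟨ ℤₚ.[+m]-[+n]≡m⊖n c (c ℕ.∸ i ℕ.+ n) ⟨
  + c ℤ.- + (c ℕ.∸ i ℕ.+ n)            ∎
  where open ≡.≡-Reasoning

module Exponents where
  open import Data.Nat using (_+_; _*_; _∸_; _/_)
  open ≡ using (refl; sym; trans)
  open ≡.≡-Reasoning

  even : ℕ → Bool
  even n = evenℤ (+ n)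

  bit : Bool → ℕ
  bit b = if b then 1 else 0

  even-suc : ∀ n → even (suc n) ≡ not (even n)
  even-suc zero = refl
  even-suc (suc zero) = refl
  even-suc (suc (suc n)) = even-suc n

  evenℤ-suc : ∀ k → evenℤ (ℤ.suc k) ≡ not (evenℤ k)
  evenℤ-suc (+ n) = even-suc n
  evenℤ-suc -[1+ zero ] = refl
  evenℤ-suc -[1+ suc n ] = even-suc n

  evenℤ-+ : ∀ k s → evenℤ (k ℤ.+ + s) ≡ (if evenℤ k then even s else not (even s))
  evenℤ-+ k zero = trans (cong evenℤ (ℤₚ.+-identityʳ k)) (if-true-false (evenℤ k))
    where
    if-true-false : ∀ b → b ≡ (if b then true else false)
    if-true-false true = refl
    if-true-false false = refl
  evenℤ-+ k (suc s) = begin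
    evenℤ (k ℤ.+ + suc s)                               ≡⟨ cong evenℤ (+-sucℤ k (+ s)) ⟩
    evenℤ (ℤ.suc (k ℤ.+ + s))                           ≡⟨ evenℤ-suc (k ℤ.+ + s) ⟩
    not (evenℤ (k ℤ.+ + s))                             ≡⟨ cong not (evenℤ-+ k s) ⟩
    not (if evenℤ k then even s else not (even s))      ≡⟨ if-float not (evenℤ k) ⟩
    (if evenℤ k then not (even s) else not (not (even s)))
      ≡⟨ cong₂ (if evenℤ k then_else_) (sym (even-suc s)) (cong not (sym (even-suc s))) ⟩
    (if evenℤ k then even (suc s) else not (even (suc s))) ∎

  -- gExp s k is gᵉ s for even k and gᵒ s for odd k; note gᵒ (suc s) = gᵉ s.
  gᵉ gᵒ : ℕ → ℕ
  gᵉ s = (s / 2) * (suc s / 2)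
  gᵒ s = ((s ∸ 1) / 2) * (s / 2)

  half-suc-suc : ∀ s → suc (suc s) / 2 ≡ suc (s / 2)
  half-suc-suc s = m/n≡1+[m∸n]/n {suc (suc s)} {2} (ℕ.s≤s (ℕ.s≤s ℕ.z≤n))

  half-suc : ∀ s → suc s / 2 + bit (even s) ≡ suc (s / 2)
  half-suc zero = refl
  half-suc (suc zero) = refl
  half-suc (suc (suc s)) = begin
    suc (suc (suc s)) / 2 + bit (even s)  ≡⟨ cong (_+ bit (even s)) (half-suc-suc (suc s)) ⟩
    suc (suc s / 2 + bit (even s))        ≡⟨ cong suc (half-suc s) ⟩
    suc (suc (s / 2))                     ≡⟨ cong suc (half-suc-suc s) ⟨
    suc (suc (suc s) / 2)                 ∎

  gᵉ-recurrence : ∀ s → gᵉ (suc s) + gᵉ (suc s) + bit (even s) ≡ gᵉ (suc (suc s)) + gᵉ s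
  gᵉ-recurrence s = begin
    h′ * (suc (suc s) / 2) + h′ * (suc (suc s) / 2) + d
      ≡⟨ cong (λ t → h′ * t + h′ * t + d) (half-suc-suc s) ⟩
    h′ * suc h + h′ * suc h + d     ≡⟨ expand h h′ d ⟩
    (h′ + d) + (h′ + 2 * (h * h′))  ≡⟨ cong (_+ (h′ + 2 * (h * h′))) (half-suc s) ⟩
    suc h + (h′ + 2 * (h * h′))     ≡⟨ collect h h′ ⟩
    suc h * suc h′ + h * h′
      ≡⟨ cong₂ (λ a b → a * b + h * h′) (half-suc-suc s) (half-suc-suc (suc s)) ⟨
    gᵉ (suc (suc s)) + gᵉ s         ∎
    where
    h h′ d : ℕ
    h = s / 2
    h′ = suc s / 2
    d = bit (even s)
    expand : ∀ a b c → b * (1 + a) + b * (1 + a) + c ≡ (b + c) + (b + 2 * (a * b))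
    expand = solve-∀
    collect : ∀ a b → (1 + a) + (b + 2 * (a * b)) ≡ (1 + a) * (1 + b) + a * b
    collect = solve-∀

  gᵒ-recurrence : ∀ s → gᵒ (suc s) + gᵒ (suc s) + bit (not (even s)) ≡ gᵒ (suc (suc s)) + gᵒ s
  gᵒ-recurrence zero = refl
  gᵒ-recurrence (suc s) rewrite even-suc s | not-involutive (even s) = gᵉ-recurrence s

  gExp-recurrence : ∀ s k → gExp (suc s) k + gExp (suc s) k + bit (evenℤ (k ℤ.+ + s))
                            ≡ gExp (suc (suc s)) k + gExp s k
  gExp-recurrence s k rewrite evenℤ-+ k s with evenℤ k
  ... | true = gᵉ-recurrence s
  ... | false = gᵒ-recurrence s

  gExp-recurrence-+1 : ∀ s k → gExp (suc s) (k ℤ.+ + 1) + gExp (suc s) (k ℤ.+ + 1) + bit (not (evenℤ (k ℤ.+ + s)))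
                               ≡ gExp (suc (suc s)) (k ℤ.+ + 1) + gExp s (k ℤ.+ + 1)
  gExp-recurrence-+1 s k = begin
    g₁ + g₁ + bit (not (evenℤ (k ℤ.+ + s)))    ≡⟨ cong (λ b → g₁ + g₁ + bit b) (evenℤ-suc (k ℤ.+ + s)) ⟨
    g₁ + g₁ + bit (evenℤ (ℤ.suc (k ℤ.+ + s)))  ≡⟨ cong (λ i → g₁ + g₁ + bit (evenℤ i)) (reassoc k (+ s)) ⟨
    g₁ + g₁ + bit (evenℤ (k ℤ.+ + 1 ℤ.+ + s))  ≡⟨ gExp-recurrence s (k ℤ.+ + 1) ⟩
    gExp (suc (suc s)) (k ℤ.+ + 1) + gExp s (k ℤ.+ + 1) ∎
    where
    g₁ : ℕ
    g₁ = gExp (suc s) (k ℤ.+ + 1)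
    reassoc : ∀ i j → i ℤ.+ + 1 ℤ.+ j ≡ + 1 ℤ.+ (i ℤ.+ j)
    reassoc = ℤ-solve-∀

  gExp-zero : ∀ k → gExp 0 k ≡ 0
  gExp-zero k = if-eta (evenℤ k)

  gExp-one : ∀ k → gExp 1 k ≡ 0
  gExp-one k = if-eta (evenℤ k)

open Exponents
module SemifieldProperties {c ℓ} (S : Semifield c ℓ) where
  open Semifield S renaming (_≈_ to infix 4 _≈_)
  open Over S using (_÷_; ∏) renaming (_^_ to infixr 8 _^_)

  *-abelianGroup : AbelianGroup c ℓ
  *-abelianGroup = record { isAbelianGroup = *-isAbelianGroup }

  open AbelianGroup *-abelianGroup public
    using (setoid; isEquivalence; refl; sym; trans; reflexive)
    renaming (∙-cong to *-cong; ∙-congˡ to *-congˡ; ∙-congʳ to *-congʳ; assoc to *-assoc; comm to *-comm;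
              identityˡ to *-identityˡ; identityʳ to *-identityʳ; commutativeMonoid to *-commutativeMonoid;
              monoid to *-monoid; commutativeSemigroup to *-commutativeSemigroup)
  open IsCommutativeSemigroup +-isCommutativeSemigroup public
    using () renaming (∙-cong to +-cong; comm to +-comm; isSemigroup to +-isSemigroup)
  open Algebra.Properties.AbelianGroup *-abelianGroup using (//-cong₂; //-rightDividesˡ; //-rightDividesʳ)
  open Algebra.Properties.CommutativeSemigroup *-commutativeSemigroup public
    using () renaming (interchange to *-interchange)
  open Algebra.Properties.Monoid.Mult *-monoid using (_×_; ×-cong; ×-homo-+)
  open Relation.Binary.Reasoning.Setoid setoid

  ÷-cong : ∀ {a b u v} → a ≈ b → u ≈ v → a ÷ u ≈ b ÷ v
  ÷-cong = //-cong₂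

  ÷-*-cancel : ∀ a u → (a ÷ u) * u ≈ a
  ÷-*-cancel a u = //-rightDividesˡ u a

  ÷-unique : ∀ {a u w} → u * w ≈ a → a ÷ u ≈ w
  ÷-unique {a} {u} {w} uw≈a = begin
    a ÷ u        ≈⟨ ÷-cong uw≈a refl ⟨
    (u * w) ÷ u  ≈⟨ ÷-cong (*-comm u w) refl ⟩
    (w * u) ÷ u  ≈⟨ //-rightDividesʳ u w ⟩
    w            ∎

  ÷-cross : ∀ {a b u v} → a * v ≈ b * u → a ÷ u ≈ b ÷ v
  ÷-cross {a} {b} {u} {v} av≈bu = ÷-unique (begin
    u * (b ÷ v)        ≈⟨ *-assoc u b (v ⁻¹) ⟨
    u * b ÷ v          ≈⟨ ÷-cong (trans (*-comm u b) (sym av≈bu)) refl ⟩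
    a * v ÷ v          ≈⟨ //-rightDividesʳ v a ⟩
    a                  ∎)

  ^≡× : ∀ x n → x ^ n ≡ n × x
  ^≡× x zero = ≡.refl
  ^≡× x (suc n) = ≡.cong (x *_) (^≡× x n)

  ^-cong : ∀ {x y m n} → x ≈ y → m ≡ n → x ^ m ≈ y ^ n
  ^-cong {x} {y} {m} {n} x≈y m≡n = begin
    x ^ m  ≡⟨ ^≡× x m ⟩
    m × x  ≈⟨ ×-cong m≡n x≈y ⟩
    n × y  ≡⟨ ^≡× y n ⟨
    y ^ n  ∎

  ^-homo-+ : ∀ x m n → x ^ (m ℕ.+ n) ≈ x ^ m * x ^ n
  ^-homo-+ x m n = begin
    x ^ (m ℕ.+ n)      ≡⟨ ^≡× x (m ℕ.+ n) ⟩
    (m ℕ.+ n) × x      ≈⟨ ×-homo-+ x m n ⟩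
    m × x * n × x    ≡⟨ ≡.cong₂ _*_ (^≡× x m) (^≡× x n) ⟨
    x ^ m * x ^ n    ∎

  ^-homo-+₂ : ∀ x y a b a′ b′ → (x ^ a * y ^ b) * (x ^ a′ * y ^ b′) ≈ x ^ (a ℕ.+ a′) * y ^ (b ℕ.+ b′)
  ^-homo-+₂ x y a b a′ b′ =
    trans (*-interchange _ _ _ _) (sym (*-cong (^-homo-+ x a a′) (^-homo-+ y b b′)))

  ∏-cong : ∀ {n} {f g : Fin n → Carrier} → (∀ i → f i ≈ g i) → ∏ f ≈ ∏ g
  ∏-cong {zero} f≈g = refl
  ∏-cong {suc n} f≈g = *-cong (f≈g zero) (∏-cong (λ i → f≈g (suc i)))

  -- A semifield has no zero; adjoining one as a new point gives a commutative
  -- semiring, so the semiring solver proves subtraction-free identities of S.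
  infixl 7 _*₀_
  infixl 6 _+₀_
  _+₀_ _*₀_ : Op₂ (Pointed Carrier)
  _+₀_ = liftOp _+_
  [ a ] *₀ [ b ] = [ a * b ]
  _     *₀ _     = ∙

  infix 4 _≈₀_
  _≈₀_ : Rel (Pointed Carrier) (c ⊔ ℓ)
  _≈₀_ = _≈∙_ _≈_

  ≈₀-refl : ∀ {x} → x ≈₀ x
  ≈₀-refl = ≈∙-refl _≈_ refl

  unlift : ∀ {a b} → [ a ] ≈₀ [ b ] → a ≈ b
  unlift = [≈]-injective _≈_

  private
    +₀-comm : ∀ x y → x +₀ y ≈₀ y +₀ x
    +₀-comm [ a ] [ b ] = [ +-comm a b ]
    +₀-comm [ a ] ∙ = ≈₀-refl
    +₀-comm ∙ [ b ] = ≈₀-refl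
    +₀-comm ∙ ∙ = ≈₀-refl

    *₀-cong : ∀ {x y u v} → x ≈₀ y → u ≈₀ v → x *₀ u ≈₀ y *₀ v
    *₀-cong [ a≈b ] [ u≈v ] = [ *-cong a≈b u≈v ]
    *₀-cong [ _ ] ∙≈∙ = ∙≈∙
    *₀-cong ∙≈∙ _ = ∙≈∙

    *₀-assoc : ∀ x y z → (x *₀ y) *₀ z ≈₀ x *₀ (y *₀ z)
    *₀-assoc [ a ] [ b ] [ d ] = [ *-assoc a b d ]
    *₀-assoc [ a ] [ b ] ∙ = ∙≈∙
    *₀-assoc [ a ] ∙ _ = ∙≈∙
    *₀-assoc ∙ _ _ = ∙≈∙

    *₀-comm : ∀ x y → x *₀ y ≈₀ y *₀ x
    *₀-comm [ a ] [ b ] = [ *-comm a b ]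
    *₀-comm [ a ] ∙ = ∙≈∙
    *₀-comm ∙ [ b ] = ∙≈∙
    *₀-comm ∙ ∙ = ∙≈∙

    *₀-identityˡ : ∀ x → [ 1# ] *₀ x ≈₀ x
    *₀-identityˡ [ a ] = [ *-identityˡ a ]
    *₀-identityˡ ∙ = ∙≈∙

    *₀-distribʳ : ∀ x y z → (y +₀ z) *₀ x ≈₀ y *₀ x +₀ z *₀ x
    *₀-distribʳ [ a ] [ b ] [ d ] = [ proj₂ distrib a b d ]
    *₀-distribʳ [ a ] [ b ] ∙ = ≈₀-refl
    *₀-distribʳ [ a ] ∙ [ d ] = ≈₀-refl
    *₀-distribʳ [ a ] ∙ ∙ = ∙≈∙
    *₀-distribʳ ∙ [ b ] [ d ] = ∙≈∙
    *₀-distribʳ ∙ [ b ] ∙ = ∙≈∙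
    *₀-distribʳ ∙ ∙ [ d ] = ∙≈∙
    *₀-distribʳ ∙ ∙ ∙ = ∙≈∙

  withZero : CommutativeSemiring c (c ⊔ ℓ)
  withZero = record
    { isCommutativeSemiring = IsCommutativeSemiringˡ.isCommutativeSemiring record
      { +-isCommutativeMonoid = record { isMonoid = AddIdentity.isMonoid +-isSemigroup ; comm = +₀-comm }
      ; *-isCommutativeMonoid = record
        { isMonoid = record
          { isSemigroup = record
            { isMagma = record { isEquivalence = ≈∙-isEquivalence _≈_ isEquivalence ; ∙-cong = *₀-cong }
            ; assoc = *₀-assoc }
          ; identity = *₀-identityˡ , λ x → ≈∙-trans _≈_ trans (*₀-comm x [ 1# ]) (*₀-identityˡ x) }
        ; comm = *₀-comm }
      ; distribʳ = *₀-distribʳ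
      ; zeroˡ = λ _ → ∙≈∙ } }

  module WithZeroSolver = Algebra.Solver.Ring.NaturalCoefficients.Default withZero

quiver-≟ : (a b : Quiver) → Dec (∀ j k → a j k ≡ b j k)
quiver-≟ a b = all? λ j → all? λ k → a j k ℕ.≟ b j k

module Seeds {c ℓ} (S : Semifield c ℓ) where
  open Semifield S renaming (_≈_ to infix 4 _≈_)
  open Over S renaming (_^_ to infixr 8 _^_)
  open SemifieldProperties S

  Cluster : Set c
  Cluster = Fin 5 → Carrier

  infix 4 _≐_ _≈ˢ_
  _≐_ : Rel Cluster ℓ
  y ≐ z = ∀ j → y j ≈ z j

  record _≈ˢ_ (t u : Seed) : Set ℓ where
    field
      quiver-≡  : ∀ j k → quiver t j k ≡ quiver u j k
      cluster-≈ : cluster t ≐ cluster u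
  open _≈ˢ_ public

  ≈ˢ-trans : ∀ {t u v} → t ≈ˢ u → u ≈ˢ v → t ≈ˢ v
  ≈ˢ-trans t≈u u≈v = record
    { quiver-≡ = λ j k → ≡.trans (quiver-≡ t≈u j k) (quiver-≡ u≈v j k)
    ; cluster-≈ = λ j → trans (cluster-≈ t≈u j) (cluster-≈ u≈v j) }

  seed-cong : ∀ {a y z} → y ≐ z → seed a y ≈ˢ seed a z
  seed-cong y≐z = record { quiver-≡ = λ _ _ → ≡.refl ; cluster-≈ = y≐z }

  mutQ-cong : ∀ i {a b : Quiver} → (∀ j k → a j k ≡ b j k) → ∀ j k → mutQ i a j k ≡ mutQ i b j k
  mutQ-cong i a≡b j k with ⌊ j ≟ i ⌋ ∨ ⌊ k ≟ i ⌋
  ... | true  = a≡b k j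
  ... | false = cong₂ ℕ._∸_ (cong₂ ℕ._+_ (a≡b j k) (cong₂ ℕ._*_ (a≡b j i) (a≡b i k)))
                           (cong₂ ℕ._+_ (a≡b k j) (cong₂ ℕ._*_ (a≡b k i) (a≡b i j)))

  μ-cong : ∀ i {t u} → t ≈ˢ u → μ i t ≈ˢ μ i u
  μ-cong i {seed a y} {seed b z} t≈u = record
    { quiver-≡ = mutQ-cong i (quiver-≡ t≈u) ; cluster-≈ = cluster′-≈ }
    where
    monomial-≈ : ∀ {e f : Fin 5 → ℕ} → (∀ l → e l ≡ f l) → ∏ (λ l → y l ^ e l) ≈ ∏ (λ l → z l ^ f l)
    monomial-≈ e≡f = ∏-cong (λ l → ^-cong (cluster-≈ t≈u l) (e≡f l))
    cluster′-≈ : cluster (μ i (seed a y)) ≐ cluster (μ i (seed b z))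
    cluster′-≈ j with ⌊ j ≟ i ⌋
    ... | true  = ÷-cong (+-cong (monomial-≈ (quiver-≡ t≈u i)) (monomial-≈ (λ l → quiver-≡ t≈u l i)))
                         (cluster-≈ t≈u i)
    ... | false = cluster-≈ t≈u j

  relabel-cong : ∀ σ {t u} → t ≈ˢ u → relabel σ t ≈ˢ relabel σ u
  relabel-cong σ {seed a y} {seed b z} t≈u = record
    { quiver-≡ = λ j k → quiver-≡ t≈u (σ ⟨$⟩ˡ j) (σ ⟨$⟩ˡ k)
    ; cluster-≈ = λ j → cluster-≈ t≈u (σ ⟨$⟩ˡ j) }

  ρ₁-cong : ∀ {t u} → t ≈ˢ u → ρ₁ t ≈ˢ ρ₁ u
  ρ₁-cong = relabel-cong σ54321 ∘ μ-cong v1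

  ρ₂-cong : ∀ {t u} → t ≈ˢ u → ρ₂ t ≈ˢ ρ₂ u
  ρ₂-cong = relabel-cong σ12345 ∘ μ-cong v5

  ρ₃-cong : ∀ {t u} → t ≈ˢ u → ρ₃ t ≈ˢ ρ₃ u
  ρ₃-cong = relabel-cong σ24 ∘ μ-cong v4 ∘ μ-cong v2

  module ⊙ = Algebra.Solver.CommutativeMonoid *-commutativeMonoid
  open ⊙ using (var; _⊕_)

  -- For a concrete exponent vector a, ⟦ monomial a ⟧ (tabulate y) is definitionally the exchange
  -- monomial ∏ (λ l → y l ^ a l) of μ, so the solver can normalise it.
  monomial : ∀ {n} → (Fin n → ℕ) → ⊙.Expr n
  monomial a = product (λ l → power (var l) (a l))
    where
    power : ∀ {n} → ⊙.Expr n → ℕ → ⊙.Expr n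
    power e zero = ⊙.id
    power e (suc k) = e ⊕ power e k
    product : ∀ {m n} → (Fin m → ⊙.Expr n) → ⊙.Expr n
    product {zero} e = ⊙.id
    product {suc m} e = e zero ⊕ product (λ i → e (suc i))

  y₁ y₂ y₃ y₄ y₅ : ⊙.Expr 5
  y₁ = var v1
  y₂ = var v2
  y₃ = var v3
  y₄ = var v4
  y₅ = var v5

  shift unshift exchange : Cluster → Cluster
  shift y zero = y v2
  shift y (suc zero) = y v3
  shift y (suc (suc zero)) = y v4
  shift y (suc (suc (suc zero))) = y v5
  shift y (suc (suc (suc (suc zero)))) = (y v5 * y v2 + y v4 * y v3) ÷ y v1

  unshift y zero = (y v4 * y v1 + y v3 * y v2) ÷ y v5
  unshift y (suc zero) = y v1
  unshift y (suc (suc zero)) = y v2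
  unshift y (suc (suc (suc zero))) = y v3
  unshift y (suc (suc (suc (suc zero)))) = y v4

  exchange y zero = y v1
  exchange y (suc zero) = (y v1 * y v5 + y v3 * y v3) ÷ y v4
  exchange y (suc (suc zero)) = y v3
  exchange y (suc (suc (suc zero))) = (y v1 * y v5 + y v3 * y v3) ÷ y v2
  exchange y (suc (suc (suc (suc zero)))) = y v5

  ρ₁-seed-Q₀ : ∀ y → ρ₁ (seed Q₀ y) ≈ˢ seed Q₀ (shift y)
  ρ₁-seed-Q₀ y = record
    { quiver-≡ = from-yes (quiver-≟ (quiver (ρ₁ (seed Q₀ y))) Q₀) ; cluster-≈ = cluster-≈′ }
    where
    cluster-≈′ : cluster (ρ₁ (seed Q₀ y)) ≐ shift y
    cluster-≈′ zero = refl
    cluster-≈′ (suc zero) = refl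
    cluster-≈′ (suc (suc zero)) = refl
    cluster-≈′ (suc (suc (suc zero))) = refl
    cluster-≈′ (suc (suc (suc (suc zero)))) = ÷-cong
      (+-cong (⊙.prove 5 (monomial (Q₀ v1)) (y₅ ⊕ y₂) (tabulate y))
              (⊙.prove 5 (monomial (λ l → Q₀ l v1)) (y₄ ⊕ y₃) (tabulate y)))
      refl

  ρ₂-seed-Q₀ : ∀ y → ρ₂ (seed Q₀ y) ≈ˢ seed Q₀ (unshift y)
  ρ₂-seed-Q₀ y = record
    { quiver-≡ = from-yes (quiver-≟ (quiver (ρ₂ (seed Q₀ y))) Q₀) ; cluster-≈ = cluster-≈′ }
    where
    cluster-≈′ : cluster (ρ₂ (seed Q₀ y)) ≐ unshift y
    cluster-≈′ zero = ÷-cong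
      (trans (+-comm _ _) (+-cong (⊙.prove 5 (monomial (λ l → Q₀ l v5)) (y₄ ⊕ y₁) (tabulate y))
                                  (⊙.prove 5 (monomial (Q₀ v5)) (y₃ ⊕ y₂) (tabulate y))))
      refl
    cluster-≈′ (suc zero) = refl
    cluster-≈′ (suc (suc zero)) = refl
    cluster-≈′ (suc (suc (suc zero))) = refl
    cluster-≈′ (suc (suc (suc (suc zero)))) = refl

  ρ₃-seed-Q₀ : ∀ y → ρ₃ (seed Q₀ y) ≈ˢ seed Q₀ (exchange y)
  ρ₃-seed-Q₀ y = record
    { quiver-≡ = from-yes (quiver-≟ (quiver (ρ₃ (seed Q₀ y))) Q₀) ; cluster-≈ = cluster-≈′ }
    where
    cluster-≈′ : cluster (ρ₃ (seed Q₀ y)) ≐ exchange y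
    cluster-≈′ zero = refl
    cluster-≈′ (suc zero) = ÷-cong
      (+-cong (⊙.prove 5 (monomial (mutQ v2 Q₀ v4)) (y₁ ⊕ y₅) (tabulate y))
              (⊙.prove 5 (monomial (λ l → mutQ v2 Q₀ l v4)) (y₃ ⊕ y₃) (tabulate y)))
      refl
    cluster-≈′ (suc (suc zero)) = refl
    cluster-≈′ (suc (suc (suc zero))) = ÷-cong
      (trans (+-comm _ _) (+-cong (⊙.prove 5 (monomial (λ l → Q₀ l v2)) (y₁ ⊕ y₅) (tabulate y))
                                  (⊙.prove 5 (monomial (Q₀ v2)) (y₃ ⊕ y₃) (tabulate y))))
      refl
    cluster-≈′ (suc (suc (suc (suc zero)))) = refl

  ρ₁-step : ∀ {t y} → t ≈ˢ seed Q₀ y → ρ₁ t ≈ˢ seed Q₀ (shift y)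
  ρ₁-step t≈ = ≈ˢ-trans (ρ₁-cong t≈) (ρ₁-seed-Q₀ _)

  ρ₂-step : ∀ {t y} → t ≈ˢ seed Q₀ y → ρ₂ t ≈ˢ seed Q₀ (unshift y)
  ρ₂-step t≈ = ≈ˢ-trans (ρ₂-cong t≈) (ρ₂-seed-Q₀ _)

  ρ₃-step : ∀ {t y} → t ≈ˢ seed Q₀ y → ρ₃ t ≈ˢ seed Q₀ (exchange y)
  ρ₃-step t≈ = ≈ˢ-trans (ρ₃-cong t≈) (ρ₃-seed-Q₀ _)

module Somos {c ℓ} (S : Semifield c ℓ) where
  open Semifield S renaming (_≈_ to infix 4 _≈_)
  open Over S renaming (_^_ to infixr 8 _^_)
  open SemifieldProperties S
  open Seeds S
  open WithZeroSolver using (solve; _:=_; _:+_; _:*_)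
  open Relation.Binary.Reasoning.Setoid setoid

  SomosAt : (ℕ → Carrier) → Set ℓ
  SomosAt u = u 0 * u 5 ≈ u 4 * u 1 + u 3 * u 2

  SomosAt-cong : ∀ u v → (∀ (i : Fin 6) → u (toℕ i) ≈ v (toℕ i)) → SomosAt u → SomosAt v
  SomosAt-cong u v u≈v rel = begin
    v 0 * v 5              ≈⟨ *-cong (u≈v (# 0)) (u≈v (# 5)) ⟨
    u 0 * u 5              ≈⟨ rel ⟩
    u 4 * u 1 + u 3 * u 2  ≈⟨ +-cong (*-cong (u≈v (# 4)) (u≈v (# 1))) (*-cong (u≈v (# 3)) (u≈v (# 2))) ⟩
    v 4 * v 1 + v 3 * v 2  ∎

  SomosAt-reverse : ∀ u → SomosAt u → SomosAt (λ i → u (5 ℕ.∸ i))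
  SomosAt-reverse u rel = begin
    u 5 * u 0              ≈⟨ *-comm (u 5) (u 0) ⟩
    u 0 * u 5              ≈⟨ rel ⟩
    u 4 * u 1 + u 3 * u 2  ≈⟨ +-cong (*-comm (u 4) (u 1)) (*-comm (u 3) (u 2)) ⟩
    u 1 * u 4 + u 2 * u 3  ∎

  run-somos : ∀ a b c d e p → SomosAt (λ i → run a b c d e (i ℕ.+ p))
  run-somos a b c d e zero = begin
    a * ((e * b + d * c) ÷ a)  ≈⟨ *-comm a _ ⟩
    (e * b + d * c) ÷ a * a    ≈⟨ ÷-*-cancel (e * b + d * c) a ⟩
    e * b + d * c              ∎
  run-somos a b c d e (suc p) = run-somos b c d e ((e * b + d * c) ÷ a) p

  exchangeRatio : (ℕ → Carrier) → Carrier
  exchangeRatio u = (u 1 * u 5 + u 3 * u 3) ÷ (u 2 * u 4)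

  exchangeRatio-cong : ∀ u v → (∀ (i : Fin 6) → u (toℕ i) ≈ v (toℕ i)) → exchangeRatio u ≈ exchangeRatio v
  exchangeRatio-cong u v u≈v =
    ÷-cong (+-cong (*-cong (u≈v (# 1)) (u≈v (# 5))) (*-cong (u≈v (# 3)) (u≈v (# 3)))) (*-cong (u≈v (# 2)) (u≈v (# 4)))

  exchangeRatio-period : ∀ u → SomosAt (λ i → u (1 ℕ.+ i)) → SomosAt (λ i → u (2 ℕ.+ i)) →
                         exchangeRatio (λ i → u (2 ℕ.+ i)) ≈ exchangeRatio u
  exchangeRatio-period u r₁ r₂ = ÷-cross (begin
    (u 3 * u 7 + u 5 * u 5) * (u 2 * u 4)
      ≈⟨ unlift (solve 5 (λ a₂ a₃ a₄ a₅ a₇ → (a₃ :* a₇ :+ a₅ :* a₅) :* (a₂ :* a₄)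
                                              := a₃ :* a₄ :* (a₂ :* a₇) :+ a₂ :* a₄ :* (a₅ :* a₅))
                         ≈₀-refl [ u 2 ] [ u 3 ] [ u 4 ] [ u 5 ] [ u 7 ]) ⟩
    u 3 * u 4 * (u 2 * u 7) + u 2 * u 4 * (u 5 * u 5)
      ≈⟨ +-cong (*-congˡ r₂) refl ⟩
    u 3 * u 4 * (u 6 * u 3 + u 5 * u 4) + u 2 * u 4 * (u 5 * u 5)
      ≈⟨ unlift (solve 5 (λ a₂ a₃ a₄ a₅ a₆ → a₃ :* a₄ :* (a₆ :* a₃ :+ a₅ :* a₄) :+ a₂ :* a₄ :* (a₅ :* a₅)
                                              := a₄ :* a₅ :* (a₅ :* a₂ :+ a₄ :* a₃) :+ a₃ :* a₃ :* (a₄ :* a₆))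
                         ≈₀-refl [ u 2 ] [ u 3 ] [ u 4 ] [ u 5 ] [ u 6 ]) ⟩
    u 4 * u 5 * (u 5 * u 2 + u 4 * u 3) + u 3 * u 3 * (u 4 * u 6)
      ≈⟨ +-cong (*-congˡ r₁) refl ⟨
    u 4 * u 5 * (u 1 * u 6) + u 3 * u 3 * (u 4 * u 6)
      ≈⟨ unlift (solve 5 (λ a₁ a₃ a₄ a₅ a₆ → a₄ :* a₅ :* (a₁ :* a₆) :+ a₃ :* a₃ :* (a₄ :* a₆)
                                              := (a₁ :* a₅ :+ a₃ :* a₃) :* (a₄ :* a₆))
                         ≈₀-refl [ u 1 ] [ u 3 ] [ u 4 ] [ u 5 ] [ u 6 ]) ⟩
    (u 1 * u 5 + u 3 * u 3) * (u 4 * u 6)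
      ∎)

  module Sequence (x : Fin 5 → Carrier) where
    open Seq x

    X : ℤ → ℕ → Carrier
    X m i = xs (m ℤ.+ + i)

    X-suc : ∀ m i → X (ℤ.suc m) i ≡ X m (suc i)
    X-suc m i = cong xs (sucℤ-+ m (+ i))

    X-pred : ∀ m i → X (ℤ.pred m) (suc i) ≡ X m i
    X-pred m i = ≡.trans (≡.sym (X-suc (ℤ.pred m) i)) (cong (λ n → X n i) (ℤₚ.suc-pred m))

    X-forward : ∀ p i → X (+ suc p) i ≡ F (i ℕ.+ p)
    X-forward p i = cong F (ℕₚ.+-comm p i)

    xs-backward : ∀ n → xs (+ 5 ℤ.- + n) ≡ G n
    xs-backward 0 = ≡.refl
    xs-backward 1 = ≡.refl
    xs-backward 2 = ≡.refl
    xs-backward 3 = ≡.refl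
    xs-backward 4 = ≡.refl
    xs-backward 5 = ≡.refl
    xs-backward (suc (suc (suc (suc (suc (suc n)))))) = ≡.refl

    X-backward : ∀ n (i : Fin 6) → X (ℤ.- + n) (toℕ i) ≡ G (5 ℕ.∸ toℕ i ℕ.+ n)
    X-backward n i = ≡.trans (cong xs (-+-reindex n (toℕ≤pred[n] i))) (xs-backward (5 ℕ.∸ toℕ i ℕ.+ n))

    somos-positive : ∀ p → SomosAt (X (+ suc p))
    somos-positive p = SomosAt-cong (λ i → F (i ℕ.+ p)) (X (+ suc p))
      (λ i → reflexive (≡.sym (X-forward p (toℕ i))))
      (run-somos (x v1) (x v2) (x v3) (x v4) (x v5) p)

    somos-nonpositive : ∀ n → SomosAt (X (ℤ.- + n))
    somos-nonpositive n = SomosAt-cong (λ i → G (5 ℕ.∸ i ℕ.+ n)) (X (ℤ.- + n))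
      (λ i → reflexive (≡.sym (X-backward n i)))
      (SomosAt-reverse (λ i → G (i ℕ.+ n)) (run-somos (x v5) (x v4) (x v3) (x v2) (x v1) n))

    somos : ∀ m → SomosAt (X m)
    somos (+ suc p) = somos-positive p
    somos (+ zero) = somos-nonpositive 0
    somos -[1+ n ] = somos-nonpositive (suc n)

    somos-from : ∀ m a → SomosAt (λ i → X m (a ℕ.+ i))
    somos-from m a = SomosAt-cong (X (m ℤ.+ + a)) (λ i → X m (a ℕ.+ i))
      (λ i → reflexive (cong xs (ℤₚ.+-assoc m (+ a) (+ toℕ i)))) (somos (m ℤ.+ + a))

    window : ℤ → Cluster
    window m j = X m (suc (toℕ j))

    initial-window : x ≐ window (+ 0)
    initial-window zero = refl
    initial-window (suc zero) = refl
    initial-window (suc (suc zero)) = refl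
    initial-window (suc (suc (suc zero))) = refl
    initial-window (suc (suc (suc (suc zero)))) = refl

    shift-window : ∀ m → shift (window m) ≐ window (ℤ.suc m)
    shift-window m zero = reflexive (≡.sym (X-suc m 1))
    shift-window m (suc zero) = reflexive (≡.sym (X-suc m 2))
    shift-window m (suc (suc zero)) = reflexive (≡.sym (X-suc m 3))
    shift-window m (suc (suc (suc zero))) = reflexive (≡.sym (X-suc m 4))
    shift-window m (suc (suc (suc (suc zero)))) =
      trans (÷-unique (somos-from m 1)) (reflexive (≡.sym (X-suc m 5)))

    unshift-window : ∀ m → unshift (window m) ≐ window (ℤ.pred m)
    unshift-window m zero =
      trans (÷-unique (trans (*-comm (X m 5) (X m 0)) (somos m))) (reflexive (≡.sym (X-pred m 0)))
    unshift-window m (suc zero) = reflexive (≡.sym (X-pred m 1))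
    unshift-window m (suc (suc zero)) = reflexive (≡.sym (X-pred m 2))
    unshift-window m (suc (suc (suc zero))) = reflexive (≡.sym (X-pred m 3))
    unshift-window m (suc (suc (suc (suc zero)))) = reflexive (≡.sym (X-pred m 4))

    ρ₁^-window : ∀ k → ρ₁^ k (seed Q₀ x) ≈ˢ seed Q₀ (window k)
    ρ₁^-window (+ n) = ≡.subst (λ m → iter ρ₁ n (seed Q₀ x) ≈ˢ seed Q₀ (window m)) (iter-sucℤ n)
      (iter-preserves (λ t m → t ≈ˢ seed Q₀ (window m))
                      (λ {_} {m} t≈ → ≈ˢ-trans (ρ₁-step t≈) (seed-cong (shift-window m)))
                      n {v = + 0} (seed-cong initial-window))
    ρ₁^-window -[1+ n ] = ≡.subst (λ m → iter ρ₂ (suc n) (seed Q₀ x) ≈ˢ seed Q₀ (window m)) (iter-predℤ n)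
      (iter-preserves (λ t m → t ≈ˢ seed Q₀ (window m))
                      (λ {_} {m} t≈ → ≈ˢ-trans (ρ₂-step t≈) (seed-cong (unshift-window m)))
                      (suc n) {v = + 0} (seed-cong initial-window))

    exchangeRatio-X-period : ∀ m → exchangeRatio (X (ℤ.suc (ℤ.suc m))) ≈ exchangeRatio (X m)
    exchangeRatio-X-period m = trans
      (exchangeRatio-cong (X (ℤ.suc (ℤ.suc m))) (λ i → X m (2 ℕ.+ i)) (λ i → reflexive (X-suc₂ (toℕ i))))
      (exchangeRatio-period (X m) (somos-from m 1) (somos-from m 2))
      where
      X-suc₂ : ∀ i → X (ℤ.suc (ℤ.suc m)) i ≡ X m (2 ℕ.+ i)
      X-suc₂ i = ≡.trans (X-suc (ℤ.suc m) i) (X-suc m (suc i))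

    K : ℤ → Carrier
    K m = if evenℤ m then A else B

    exchangeRatio≈K : ∀ m → exchangeRatio (X m) ≈ K m
    exchangeRatio≈K (+ 0) = refl
    exchangeRatio≈K (+ 1) = refl
    exchangeRatio≈K (+ suc (suc n)) = trans (exchangeRatio-X-period (+ n)) (exchangeRatio≈K (+ n))
    exchangeRatio≈K -[1+ 0 ] = trans (sym (exchangeRatio-X-period -[1+ 0 ])) (exchangeRatio≈K (+ 1))
    exchangeRatio≈K -[1+ 1 ] = trans (sym (exchangeRatio-X-period -[1+ 1 ])) (exchangeRatio≈K (+ 0))
    exchangeRatio≈K -[1+ suc (suc n) ] =
      trans (sym (exchangeRatio-X-period -[1+ suc (suc n) ])) (exchangeRatio≈K -[1+ n ])

    K≈powers : ∀ m → K m ≈ A ^ bit (evenℤ m) * B ^ bit (not (evenℤ m))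
    K≈powers m with evenℤ m
    ... | true = sym (trans (*-identityʳ (A * 1#)) (*-identityʳ A))
    ... | false = sym (trans (*-identityˡ (B * 1#)) (*-identityʳ B))

    coef-recurrence : ∀ k s → coef (suc s) k * coef (suc s) k * K (k ℤ.+ + s) ≈ coef (suc (suc s)) k * coef s k
    coef-recurrence k s = begin
      coef (suc s) k * coef (suc s) k * K (k ℤ.+ + s)
        ≈⟨ *-cong (^-homo-+₂ A B g₁ h₁ g₁ h₁) (K≈powers (k ℤ.+ + s)) ⟩
      A ^ (g₁ ℕ.+ g₁) * B ^ (h₁ ℕ.+ h₁) * (A ^ bit e * B ^ bit (not e))
        ≈⟨ ^-homo-+₂ A B (g₁ ℕ.+ g₁) (h₁ ℕ.+ h₁) (bit e) (bit (not e)) ⟩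
      A ^ (g₁ ℕ.+ g₁ ℕ.+ bit e) * B ^ (h₁ ℕ.+ h₁ ℕ.+ bit (not e))
        ≡⟨ cong₂ (λ a b → A ^ a * B ^ b) (gExp-recurrence s k) (gExp-recurrence-+1 s k) ⟩
      A ^ (g₂ ℕ.+ g₀) * B ^ (h₂ ℕ.+ h₀)
        ≈⟨ ^-homo-+₂ A B g₂ h₂ g₀ h₀ ⟨
      coef (suc (suc s)) k * coef s k
        ∎
      where
      e : Bool
      e = evenℤ (k ℤ.+ + s)
      g₀ g₁ g₂ h₀ h₁ h₂ : ℕ
      g₀ = gExp s k
      g₁ = gExp (suc s) k
      g₂ = gExp (suc (suc s)) k
      h₀ = gExp s (k ℤ.+ + 1)
      h₁ = gExp (suc s) (k ℤ.+ + 1)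
      h₂ = gExp (suc (suc s)) (k ℤ.+ + 1)

    coef-zero : ∀ k → coef 0 k ≈ 1#
    coef-zero k = trans (*-cong (^-cong refl (gExp-zero k)) (^-cong refl (gExp-zero (k ℤ.+ + 1)))) (*-identityʳ 1#)

    coef-one : ∀ k → coef 1 k ≈ 1#
    coef-one k = trans (*-cong (^-cong refl (gExp-one k)) (^-cong refl (gExp-one (k ℤ.+ + 1)))) (*-identityʳ 1#)

    scaled : Carrier → Carrier → ℤ → Cluster
    scaled a b m zero = a * X m 1
    scaled a b m (suc zero) = b * X m 2
    scaled a b m (suc (suc zero)) = a * X m 3
    scaled a b m (suc (suc (suc zero))) = b * X m 4
    scaled a b m (suc (suc (suc (suc zero)))) = a * X m 5

    scaled-one : ∀ {a b} m → a ≈ 1# → b ≈ 1# → scaled a b m ≐ window m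
    scaled-one m a≈1 b≈1 zero = trans (*-congʳ a≈1) (*-identityˡ _)
    scaled-one m a≈1 b≈1 (suc zero) = trans (*-congʳ b≈1) (*-identityˡ _)
    scaled-one m a≈1 b≈1 (suc (suc zero)) = trans (*-congʳ a≈1) (*-identityˡ _)
    scaled-one m a≈1 b≈1 (suc (suc (suc zero))) = trans (*-congʳ b≈1) (*-identityˡ _)
    scaled-one m a≈1 b≈1 (suc (suc (suc (suc zero)))) = trans (*-congʳ a≈1) (*-identityˡ _)

    exchange-shift-scaled : ∀ {a b a′} m → a * a * K m ≈ a′ * b →
                            shift (exchange (scaled a b m)) ≐ scaled a′ a (ℤ.suc m)
    exchange-shift-scaled {a} {b} {a′} m aaK≈a′b = λ where
        zero → trans N÷bu₄ (*-congˡ (u≈ 1))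
        (suc zero) → *-congˡ (u≈ 2)
        (suc (suc zero)) → trans N÷bu₂ (*-congˡ (u≈ 3))
        (suc (suc (suc zero))) → *-congˡ (u≈ 4)
        (suc (suc (suc (suc zero)))) → trans last (*-congˡ (u≈ 5))
      where
      u : ℕ → Carrier
      u = X m
      u≈ : ∀ i → u (suc i) ≈ X (ℤ.suc m) i
      u≈ i = reflexive (≡.sym (X-suc m i))
      N : Carrier
      N = a * u 1 * (a * u 5) + a * u 3 * (a * u 3)
      N≈ : N ≈ a′ * b * (u 2 * u 4)
      N≈ = begin
        N
          ≈⟨ unlift (solve 4 (λ a u₁ u₃ u₅ → a :* u₁ :* (a :* u₅) :+ a :* u₃ :* (a :* u₃)
                                              := a :* a :* (u₁ :* u₅ :+ u₃ :* u₃))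
                             ≈₀-refl [ a ] [ u 1 ] [ u 3 ] [ u 5 ]) ⟩
        a * a * (u 1 * u 5 + u 3 * u 3)              ≈⟨ *-congˡ (÷-*-cancel _ (u 2 * u 4)) ⟨
        a * a * (exchangeRatio u * (u 2 * u 4))      ≈⟨ *-congˡ (*-congʳ (exchangeRatio≈K m)) ⟩
        a * a * (K m * (u 2 * u 4))                  ≈⟨ *-assoc (a * a) (K m) (u 2 * u 4) ⟨
        a * a * K m * (u 2 * u 4)                    ≈⟨ *-congʳ aaK≈a′b ⟩
        a′ * b * (u 2 * u 4)                         ∎
      N÷bu₄ : N ÷ (b * u 4) ≈ a′ * u 2
      N÷bu₄ = ÷-unique (trans (unlift (solve 4 (λ a′ b u₂ u₄ → b :* u₄ :* (a′ :* u₂) := a′ :* b :* (u₂ :* u₄))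
                                          ≈₀-refl [ a′ ] [ b ] [ u 2 ] [ u 4 ]))
                              (sym N≈))
      N÷bu₂ : N ÷ (b * u 2) ≈ a′ * u 4
      N÷bu₂ = ÷-unique (trans (unlift (solve 4 (λ a′ b u₂ u₄ → b :* u₂ :* (a′ :* u₄) := a′ :* b :* (u₂ :* u₄))
                                          ≈₀-refl [ a′ ] [ b ] [ u 2 ] [ u 4 ]))
                              (sym N≈))
      last : (a * u 5 * (N ÷ (b * u 4)) + N ÷ (b * u 2) * (a * u 3)) ÷ (a * u 1) ≈ a′ * u 6
      last = trans (÷-cong (+-cong (*-congˡ N÷bu₄) (*-congʳ N÷bu₂)) refl) (÷-unique (begin
        a * u 1 * (a′ * u 6)              ≈⟨ *-interchange a (u 1) a′ (u 6) ⟩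
        a * a′ * (u 1 * u 6)              ≈⟨ *-congˡ (somos-from m 1) ⟩
        a * a′ * (u 5 * u 2 + u 4 * u 3)
          ≈⟨ unlift (solve 6 (λ a a′ u₂ u₃ u₄ u₅ → a :* a′ :* (u₅ :* u₂ :+ u₄ :* u₃)
                                                    := a :* u₅ :* (a′ :* u₂) :+ a′ :* u₄ :* (a :* u₃))
                             ≈₀-refl [ a ] [ a′ ] [ u 2 ] [ u 3 ] [ u 4 ] [ u 5 ]) ⟩
        a * u 5 * (a′ * u 2) + a′ * u 4 * (a * u 3)
          ∎))

    expected≐scaled : ∀ k s → expected k s ≐ scaled (coef (suc s) k) (coef s k) (k ℤ.+ + s)
    expected≐scaled k s zero = refl
    expected≐scaled k s (suc zero) = refl
    expected≐scaled k s (suc (suc zero)) = refl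
    expected≐scaled k s (suc (suc (suc zero))) = refl
    expected≐scaled k s (suc (suc (suc (suc zero)))) = refl

    window≐expected : ∀ k → window k ≐ expected k 0
    window≐expected k j = begin
      window k j                                   ≡⟨ cong (λ m → window m j) (ℤₚ.+-identityʳ k) ⟨
      window (k ℤ.+ + 0) j                         ≈⟨ scaled-one (k ℤ.+ + 0) (coef-one k) (coef-zero k) j ⟨
      scaled (coef 1 k) (coef 0 k) (k ℤ.+ + 0) j   ≈⟨ expected≐scaled k 0 j ⟨
      expected k 0 j                               ∎

    scaled≐expected-suc : ∀ k s → scaled (coef (suc (suc s)) k) (coef (suc s) k) (ℤ.suc (k ℤ.+ + s))
                                  ≐ expected k (suc s)
    scaled≐expected-suc k s j = begin
      scaled a′ a (ℤ.suc (k ℤ.+ + s)) j  ≡⟨ cong (λ m → scaled a′ a m j) (+-sucℤ k (+ s)) ⟨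
      scaled a′ a (k ℤ.+ + suc s) j      ≈⟨ expected≐scaled k (suc s) j ⟨
      expected k (suc s) j               ∎
      where
      a a′ : Carrier
      a = coef (suc s) k
      a′ = coef (suc (suc s)) k

    ρ₃ρ₁-step : ∀ {t} k s → t ≈ˢ seed Q₀ (expected k s) → ρ₁ (ρ₃ t) ≈ˢ seed Q₀ (expected k (suc s))
    ρ₃ρ₁-step k s t≈ = ≈ˢ-trans (ρ₁-step (ρ₃-step (≈ˢ-trans t≈ (seed-cong (expected≐scaled k s)))))
      (seed-cong (λ j → trans (exchange-shift-scaled (k ℤ.+ + s) (coef-recurrence k s) j) (scaled≐expected-suc k s j)))

    applyWord-expected : ∀ k s → applyWord k s (seed Q₀ x) ≈ˢ seed Q₀ (expected k s)
    applyWord-expected k s = ≡.subst (λ s′ → applyWord k s (seed Q₀ x) ≈ˢ seed Q₀ (expected k s′)) (iter-suc s)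
      (iter-preserves (λ t s′ → t ≈ˢ seed Q₀ (expected k s′)) (λ {_} {s′} → ρ₃ρ₁-step k s′) s {v = 0}
                      (≈ˢ-trans (ρ₁^-window k) (seed-cong (window≐expected k))))

theorem4p4 : ∀ {c ℓ : Level} (S : Semifield c ℓ) (x : Fin 5 → Semifield.Carrier S)
               (k : ℤ) (s : ℕ) (i : Fin 5) →
               Semifield._≈_ S
                 (Over.cluster (Over.applyWord S k s (Over.seed Q₀ x)) i)
                 (Over.Seq.expected S x k s i)
theorem4p4 S x k s = Seeds.cluster-≈ (Somos.Sequence.applyWord-expected S x k s)
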